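{- Let $G=(X,Y;E)$ be a connected bipartite graph with bipartition classes $X,Y$, and suppose $d(x)\geq d$ for every vertex $x\in X$. (1) If $|X|\geq |Y|$, then for every vertex $y_0\in Y$, $G$ has a maximal $y_0$-path whose terminus lies in $X$ and which has order at least $2d$. (2) If $|X|>|Y|$, then for every vertex $x_0\in X$, $G$ has a maximal $x_0$-path whose terminus lies in $X$ and which has order at least $2d+1$.
   Context: Graphs are finite and simple; $d(v)$ is the degree of $v$ in $G$ and $N_G(v)$ its neighborhood. An $x$-path is a path with origin (one end-vertex) $x$; its other end-vertex is its terminus (a single vertex is a trivial path whose origin and terminus coincide). An $x$-path $P$ with terminus $y$ is a maximal $x$-path of $G$ if $N_G(y)\subseteq V(P)$. The order of a path is its number of vertices. -}

module Defs where

open import Data.Nat using (ℕ; zero; suc; _+_)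
open import Data.Bool using (Bool; true; false; if_then_else_)
open import Data.Fin using (Fin)
open import Data.List using (List; []; _∷_; length; map; allFin)
open import Data.Nat.ListAction using (sum)
open import Data.List.Relation.Unary.Unique.Propositional using (Unique)
open import Data.List.Relation.Unary.Linked using (Linked)
open import Data.List.Membership.Propositional using (_∈_)
open import Data.Product using (Σ; _×_; ∃)
open import Relation.Binary.PropositionalEquality using (_≡_)
open import Relation.Nullary using (¬_)

record Graph (n : ℕ) : Set where
  field
    adj    : Fin n → Fin n → Bool
    sym    : ∀ u v → adj u v ≡ adj v u
    irrefl : ∀ v → adj v v ≡ false

module _ {n : ℕ} (G : Graph n) where
  open Graph G

  Edge : Fin n → Fin n → Set
  Edge u v = adj u v ≡ true

  countV : (Fin n → Bool) → ℕ
  countV p = sum (map (λ w → if p w then 1 else 0) (allFin n))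

  degree : Fin n → ℕ
  degree v = countV (adj v)

  terminus : Fin n → List (Fin n) → Fin n
  terminus x []       = x
  terminus x (y ∷ ys) = terminus y ys

  IsWalk : Fin n → List (Fin n) → Set
  IsWalk x rest = Linked Edge (x ∷ rest)

  IsPath : Fin n → List (Fin n) → Set
  IsPath x rest = IsWalk x rest × Unique (x ∷ rest)

  IsMaximalPath : Fin n → List (Fin n) → Set
  IsMaximalPath x rest =
    IsPath x rest × (∀ w → Edge (terminus x rest) w → w ∈ (x ∷ rest))

  order : Fin n → List (Fin n) → ℕ
  order x rest = length (x ∷ rest)

  Connected : Set
  Connected = ∀ u v → Σ (List (Fin n)) λ rest → IsWalk u rest × terminus u rest ≡ v

  IsBipartition : (Fin n → Bool) → Set
  IsBipartition inX = ∀ u v → Edge u v → ¬ (inX u ≡ inX v)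

-- Grow the path one vertex at a time. When it has reached v, let F be the
-- vertices before v and C the component of G − F containing v; keep C
-- X-heavy: |C ∩ Y| ≤ |C ∩ X|, strictly if v ∈ X. Removing v from C turns
-- the strict requirement into the weak one and vice versa, so some
-- component D of C − v is heavy in the sense required of a vertex on the
-- other side; v has a neighbour in D because C is connected, and the path
-- steps into D. It stops only when C = {v}, which heaviness forces into X,
-- and then every neighbour of the terminus is on the path. Along a path
-- that alternates between the sides and ends in X, each Y-vertex is
-- followed by an X-vertex, so the at least d neighbours of the terminus,
-- all in Y and on the path, give order at least 2d, or 2d + 1 when the
-- path starts in X.

module Submission where

open import Data.Bool using (Bool; true; false; not; if_then_else_)
open import Data.Bool.Properties using (¬-not) renaming (_≟_ to _≟ᵇ_)
open import Data.Fin using (Fin; zero; suc; _≟_)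
open import Data.Fin.Properties using (all?; any?)
open import Data.Fin.Subset
open import Data.Fin.Subset.Properties
open import Data.Fin.Subset.Induction using (⊂-wellFounded; Acc; acc)
open import Data.List as List using (List; []; _∷_)
open import Data.List.Properties using (map-tabulate)
open import Data.List.Membership.Propositional using () renaming (_∈_ to _∈ₗ_)
open import Data.List.Relation.Unary.All as All using (All; []; _∷_)
open import Data.List.Relation.Unary.AllPairs using ([]; _∷_)
open import Data.List.Relation.Unary.Any using (here; there)
open import Data.List.Relation.Unary.Linked using ([-]; _∷_)
open import Data.Nat using (ℕ; suc; _+_; _*_; _≤_; _<_; z≤n; s≤s)
open import Data.Nat.ListAction using (sum)
open import Data.Nat.Properties hiding (_≟_)
open import Data.Product using (Σ; ∃; _×_; _,_; proj₁; proj₂)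
open import Data.Sum using (_⊎_; inj₁; inj₂; [_,_]′)
open import Data.Vec using ([]; _∷_; tabulate; here; there)
open import Data.Vec.Properties using (lookup∘tabulate; lookup⇒[]=; []=⇒lookup; tabulate-∘)
open import Function using (_∘_)
open import Relation.Binary.PropositionalEquality
open import Relation.Nullary using (¬_; Dec; yes; no; contradiction)
open import Relation.Nullary.Decidable using (_×-dec_; _⊎-dec_; _→-dec_)
open import Defs

private
  variable
    n : ℕ
    x y : Fin n
    p : Subset n

x∈tabulate⁺ : ∀ {f : Fin n → Bool} → f x ≡ true → x ∈ tabulate f
x∈tabulate⁺ {x = x} {f} fx = lookup⇒[]= x (tabulate f) (trans (lookup∘tabulate f x) fx)

x∈tabulate⁻ : ∀ {f : Fin n → Bool} → x ∈ tabulate f → f x ≡ true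
x∈tabulate⁻ {x = x} {f} x∈ = trans (sym (lookup∘tabulate f x)) ([]=⇒lookup x∈)

x∈p─q⇒x∉q : ∀ (p q : Subset n) → x ∈ p ─ q → x ∉ q
x∈p─q⇒x∉q              (inside  ∷ p) (outside ∷ q) here          = λ ()
x∈p─q⇒x∉q {x = zero}   (inside  ∷ p) (inside  ∷ q) ()
x∈p─q⇒x∉q {x = zero}   (outside ∷ p) (inside  ∷ q) ()
x∈p─q⇒x∉q {x = zero}   (outside ∷ p) (outside ∷ q) ()
x∈p─q⇒x∉q              (_       ∷ p) (_       ∷ q) (there x∈p─q) = x∈p─q⇒x∉q p q x∈p─q ∘ drop-there

x∈p-y⇒x≢y : x ∈ p - y → x ≢ y
x∈p-y⇒x≢y {p = p} {y = y} x∈p-y = x∉⁅y⁆⇒x≢y (x∈p─q⇒x∉q p ⁅ y ⁆ x∈p-y)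

Empty⇒∣p∣≡0 : ∀ {n} {p : Subset n} → Empty p → ∣ p ∣ ≡ 0
Empty⇒∣p∣≡0 {n} empty = trans (cong ∣_∣ (Empty-unique empty)) (∣⊥∣≡0 n)

∣p∣≤1+∣p-x∣ : ∀ (p : Subset n) x → ∣ p ∣ ≤ suc ∣ p - x ∣
∣p∣≤1+∣p-x∣ (inside  ∷ p) zero    = s≤s (≤-reflexive (cong ∣_∣ (sym (p─⊥≡p p))))
∣p∣≤1+∣p-x∣ (outside ∷ p) zero    = m≤n⇒m≤1+n (≤-reflexive (cong ∣_∣ (sym (p─⊥≡p p))))
∣p∣≤1+∣p-x∣ (inside  ∷ p) (suc x) = s≤s (∣p∣≤1+∣p-x∣ p x)
∣p∣≤1+∣p-x∣ (outside ∷ p) (suc x) = ∣p∣≤1+∣p-x∣ p x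

∣p∩r∣≡∣q∩r∣+∣[p─q]∩r∣ : ∀ (p q r : Subset n) → q ⊆ p →
                         ∣ p ∩ r ∣ ≡ ∣ q ∩ r ∣ + ∣ (p ─ q) ∩ r ∣
∣p∩r∣≡∣q∩r∣+∣[p─q]∩r∣ []            []            []            _   = refl
∣p∩r∣≡∣q∩r∣+∣[p─q]∩r∣ (inside  ∷ p) (outside ∷ q) (inside  ∷ r) q⊆p =
  trans (cong suc (∣p∩r∣≡∣q∩r∣+∣[p─q]∩r∣ p q r (drop-∷-⊆ q⊆p))) (sym (+-suc _ _))
∣p∩r∣≡∣q∩r∣+∣[p─q]∩r∣ (inside  ∷ p) (outside ∷ q) (outside ∷ r) q⊆p =
  ∣p∩r∣≡∣q∩r∣+∣[p─q]∩r∣ p q r (drop-∷-⊆ q⊆p)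
∣p∩r∣≡∣q∩r∣+∣[p─q]∩r∣ (outside ∷ p) (outside ∷ q) (_       ∷ r) q⊆p =
  ∣p∩r∣≡∣q∩r∣+∣[p─q]∩r∣ p q r (drop-∷-⊆ q⊆p)
∣p∩r∣≡∣q∩r∣+∣[p─q]∩r∣ (inside  ∷ p) (inside  ∷ q) (inside  ∷ r) q⊆p =
  cong suc (∣p∩r∣≡∣q∩r∣+∣[p─q]∩r∣ p q r (drop-∷-⊆ q⊆p))
∣p∩r∣≡∣q∩r∣+∣[p─q]∩r∣ (inside  ∷ p) (inside  ∷ q) (outside ∷ r) q⊆p =
  ∣p∩r∣≡∣q∩r∣+∣[p─q]∩r∣ p q r (drop-∷-⊆ q⊆p)
∣p∩r∣≡∣q∩r∣+∣[p─q]∩r∣ (outside ∷ p) (inside  ∷ q) _             q⊆p =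
  contradiction (q⊆p here) λ ()

⁅x⁆⊆p : x ∈ p → ⁅ x ⁆ ⊆ p
⁅x⁆⊆p {x = x} {p = p} x∈p y∈⁅x⁆ = subst (_∈ p) (sym (x∈⁅y⁆⇒x≡y x y∈⁅x⁆)) x∈p

∣p∩r∣≡1+∣[p-x]∩r∣ : ∀ (r : Subset n) → x ∈ p → x ∈ r → ∣ p ∩ r ∣ ≡ suc ∣ (p - x) ∩ r ∣
∣p∩r∣≡1+∣[p-x]∩r∣ {x = x} {p = p} r x∈p x∈r =
  trans (∣p∩r∣≡∣q∩r∣+∣[p─q]∩r∣ p ⁅ x ⁆ r (⁅x⁆⊆p x∈p))
        (cong (_+ ∣ (p - x) ∩ r ∣) (∣⁅x⁆∩r∣≡1 x∈r))
  where
  ∣⁅x⁆∩r∣≡1 : ∀ {n} {x : Fin n} {r} → x ∈ r → ∣ ⁅ x ⁆ ∩ r ∣ ≡ 1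
  ∣⁅x⁆∩r∣≡1 {suc n} {zero}  {inside ∷ r} here        =
    cong suc (trans (cong ∣_∣ (∩-zeroˡ r)) (∣⊥∣≡0 n))
  ∣⁅x⁆∩r∣≡1 {suc n} {suc x} {_      ∷ r} (there x∈r) = ∣⁅x⁆∩r∣≡1 x∈r

∣p∩r∣≡∣[p-x]∩r∣ : ∀ (r : Subset n) → x ∈ p → x ∉ r → ∣ p ∩ r ∣ ≡ ∣ (p - x) ∩ r ∣
∣p∩r∣≡∣[p-x]∩r∣ {x = x} {p = p} r x∈p x∉r =
  trans (∣p∩r∣≡∣q∩r∣+∣[p─q]∩r∣ p ⁅ x ⁆ r (⁅x⁆⊆p x∈p))
        (cong (_+ ∣ (p - x) ∩ r ∣) (Empty⇒∣p∣≡0 ⁅x⁆∩r-empty))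
  where
  ⁅x⁆∩r-empty : Empty (⁅ x ⁆ ∩ r)
  ⁅x⁆∩r-empty (y , y∈) with x∈p∩q⁻ ⁅ x ⁆ r y∈
  ... | y∈⁅x⁆ , y∈r = x∉r (subst (_∈ r) (x∈⁅y⁆⇒x≡y x y∈⁅x⁆) y∈r)

+-≤-split : ∀ {a b c d} → a + b ≤ c + d → a ≤ c ⊎ b ≤ d
+-≤-split {a} {b} {c} {d} a+b≤c+d with a ≤? c | b ≤? d
... | yes a≤c | _       = inj₁ a≤c
... | no  _   | yes b≤d = inj₂ b≤d
... | no  a≰c | no  b≰d = contradiction a+b≤c+d (<⇒≱ (+-mono-< (≰⇒> a≰c) (≰⇒> b≰d)))

+-<-split : ∀ {a b c d} → a + b < c + d → a < c ⊎ b < d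
+-<-split {a} {b} {c} {d} a+b<c+d with a <? c | b <? d
... | yes a<c | _       = inj₁ a<c
... | no  _   | yes b<d = inj₂ b<d
... | no  a≮c | no  b≮d = contradiction a+b<c+d (≤⇒≯ (+-mono-≤ (≮⇒≥ a≮c) (≮⇒≥ b≮d)))

∈ₗ-tail : ∀ {A : Set} {w v : A} {xs} → w ∈ₗ v ∷ xs → w ≢ v → w ∈ₗ xs
∈ₗ-tail (here  w≡v)  w≢v = contradiction w≡v w≢v
∈ₗ-tail (there w∈xs) _   = w∈xs

module _ (X : Subset n) where

  Heavy : Bool → Subset n → Set
  Heavy false C = ∣ C ∩ ∁ X ∣ ≤ ∣ C ∩ X ∣
  Heavy true  C = ∣ C ∩ ∁ X ∣ < ∣ C ∩ X ∣

  heavy-split : ∀ b {C E} → E ⊆ C → Heavy b C → Heavy b E ⊎ Heavy b (C ─ E)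
  heavy-split false {C} {E} E⊆C h =
    +-≤-split (subst₂ _≤_ (∣p∩r∣≡∣q∩r∣+∣[p─q]∩r∣ C E (∁ X) E⊆C)
                          (∣p∩r∣≡∣q∩r∣+∣[p─q]∩r∣ C E X E⊆C) h)
  heavy-split true  {C} {E} E⊆C h =
    +-<-split (subst₂ _<_ (∣p∩r∣≡∣q∩r∣+∣[p─q]∩r∣ C E (∁ X) E⊆C)
                          (∣p∩r∣≡∣q∩r∣+∣[p─q]∩r∣ C E X E⊆C) h)

  heavy-remove-∈ : ∀ {C v} → v ∈ C → v ∈ X → Heavy true C → Heavy false (C - v)
  heavy-remove-∈ {C} {v} v∈C v∈X h =
    ≤-pred (subst₂ _<_ (∣p∩r∣≡∣[p-x]∩r∣ (∁ X) v∈C (x∈p⇒x∉∁p v∈X))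
                       (∣p∩r∣≡1+∣[p-x]∩r∣ X v∈C v∈X) h)

  heavy-remove-∉ : ∀ {C v} → v ∈ C → v ∉ X → Heavy false C → Heavy true (C - v)
  heavy-remove-∉ {C} {v} v∈C v∉X h =
    subst₂ _≤_ (∣p∩r∣≡1+∣[p-x]∩r∣ (∁ X) v∈C (x∉p⇒x∈∁p v∉X))
               (∣p∩r∣≡∣[p-x]∩r∣ X v∈C v∉X) h

  empty⇒¬heavy : ∀ {C} → Empty C → ¬ Heavy true C
  empty⇒¬heavy {C} empty h =
    n≮0 (<-≤-trans h (≤-trans (∣p∩q∣≤∣p∣ C X) (≤-reflexive (Empty⇒∣p∣≡0 empty))))

countV≡∣tabulate∣ : ∀ (G : Graph n) (f : Fin n → Bool) → countV G f ≡ ∣ tabulate f ∣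
countV≡∣tabulate∣ G f =
  trans (cong sum (map-tabulate (λ w → w) (λ w → if f w then 1 else 0))) (sum-indicators f)
  where
  sum-indicators : ∀ {m} (f : Fin m → Bool) →
                   sum (List.tabulate (λ w → if f w then 1 else 0)) ≡ ∣ tabulate f ∣
  sum-indicators {0}     f = refl
  sum-indicators {suc m} f with f zero
  ... | true  = cong suc (sum-indicators (f ∘ suc))
  ... | false = sum-indicators (f ∘ suc)

module _ (G : Graph n) where
  open Graph G using (adj)

  edge-sym : ∀ {u w} → Edge G u w → Edge G w u
  edge-sym {u} {w} e = trans (Graph.sym G w u) e

  Closed : Subset n → Subset n → Set
  Closed F C = ∀ u w → u ∈ C → Edge G u w → w ∈ C ⊎ w ∈ F

  closed? : ∀ F C → Dec (Closed F C)
  closed? F C = all? λ u → all? λ w → u ∈? C →-dec adj u w ≟ᵇ true →-dec (w ∈? C ⊎-dec w ∈? F)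

  -- Together with Closed F C this says that C is a connected component of G − F.
  Indecomposable : Subset n → Subset n → Set
  Indecomposable F C = ∀ E → E ⊂ C → Nonempty E → ¬ Closed F E

  closed-─ : ∀ {F C E} → C ⊆ ∁ F → Closed F C → Closed F E → Closed F (C ─ E)
  closed-─ {F} {C} {E} C⊆∁F clC clE u w u∈C─E e with clC u w (p─q⊆p C E u∈C─E) e
  ... | inj₂ w∈F = inj₂ w∈F
  ... | inj₁ w∈C with w ∈? E
  ...   | no  w∉E = inj₁ (x∈p∧x∉q⇒x∈p─q w∈C w∉E)
  ...   | yes w∈E with clE w u w∈E (edge-sym e)
  ...     | inj₁ u∈E = contradiction u∈E (x∈p─q⇒x∉q C E u∈C─E)
  ...     | inj₂ u∈F = contradiction u∈F (x∈∁p⇒x∉p (C⊆∁F (p─q⊆p C E u∈C─E)))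

  closed-remove : ∀ {F C v} → Closed F C → Closed (F ∪ ⁅ v ⁆) (C - v)
  closed-remove {F} {C} {v} clC u w u∈C-v e with clC u w (p─q⊆p C ⁅ v ⁆ u∈C-v) e
  ... | inj₂ w∈F = inj₂ (x∈p∪q⁺ (inj₁ w∈F))
  ... | inj₁ w∈C with w ≟ v
  ...   | yes refl = inj₂ (x∈p∪q⁺ (inj₂ (x∈⁅x⁆ w)))
  ...   | no  w≢v  = inj₁ (x∈p∧x≢y⇒x∈p-y w∈C w≢v)

  avoids-remove : ∀ {F C : Subset n} {v} → C ⊆ ∁ F → C - v ⊆ ∁ (F ∪ ⁅ v ⁆)
  avoids-remove {F} {C} {v} C⊆∁F {w} w∈C-v = x∉p⇒x∈∁p λ w∈F∪v →
    [ x∈∁p⇒x∉p (C⊆∁F (p─q⊆p C ⁅ v ⁆ w∈C-v)) , x∈p─q⇒x∉q C ⁅ v ⁆ w∈C-v ]′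
      (x∈p∪q⁻ F ⁅ v ⁆ w∈F∪v)

  closed-walk : ∀ {E u} rest → Closed ⊥ E → u ∈ E → IsWalk G u rest → terminus G u rest ∈ E
  closed-walk []         _  u∈E _            = u∈E
  closed-walk (w ∷ rest) cl u∈E (e ∷ walk) with cl _ w u∈E e
  ... | inj₁ w∈E = closed-walk rest cl w∈E walk
  ... | inj₂ w∈⊥ = contradiction w∈⊥ ∉⊥

  connected⇒indecomposable : Connected G → Indecomposable ⊥ ⊤
  connected⇒indecomposable conn E (_ , x , _ , x∉E) (e , e∈E) clE with conn e x
  ... | rest , walk , reaches-x = x∉E (subst (_∈ E) reaches-x (closed-walk rest clE e∈E walk))

  neighbour-in : ∀ {F C D v} → Indecomposable F C → v ∈ C → D ⊆ C - v → Nonempty D →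
                 Closed (F ∪ ⁅ v ⁆) D → ∃ λ x → x ∈ D × Edge G v x
  neighbour-in {F} {C} {D} {v} indec v∈C D⊆C-v neD clD
    with any? (λ x → x ∈? D ×-dec adj v x ≟ᵇ true)
  ... | yes found = found
  ... | no  none  = contradiction clD-in-G-F (indec D D⊂C neD)
    where
    D⊂C : D ⊂ C
    D⊂C = ⊆-⊂-trans D⊆C-v (x∈p⇒p-x⊂p v∈C)
    clD-in-G-F : Closed F D
    clD-in-G-F u w u∈D e with clD u w u∈D e
    ... | inj₁ w∈D   = inj₁ w∈D
    ... | inj₂ w∈F∪v with x∈p∪q⁻ F ⁅ v ⁆ w∈F∪v
    ...   | inj₁ w∈F = inj₂ w∈F
    ...   | inj₂ w∈v =
      contradiction (u , u∈D , edge-sym (subst (Edge G u) (x∈⁅y⁆⇒x≡y v w∈v) e)) none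

  record Component (P : Subset n → Set) (F C : Subset n) : Set where
    field
      {part}         : Subset n
      part⊆          : part ⊆ C
      nonempty       : Nonempty part
      closed         : Closed F part
      indecomposable : Indecomposable F part
      satisfies      : P part

  module _ (P : Subset n → Set) (P-split : ∀ {C E} → E ⊆ C → P C → P E ⊎ P (C ─ E)) where

    component : ∀ {F C} → C ⊆ ∁ F → Nonempty C → Closed F C → P C → Component P F C
    component = search (⊂-wellFounded _)
      where
      widen : ∀ {F C C′} → C′ ⊆ C → Component P F C′ → Component P F C
      widen C′⊆C K = record
        { part⊆ = ⊆-trans part⊆ C′⊆C ; nonempty = nonempty ; closed = closed
        ; indecomposable = indecomposable ; satisfies = satisfies }
        where open Component K

      search : ∀ {F C} → Acc _⊂_ C → C ⊆ ∁ F → Nonempty C → Closed F C → P C → Component P F C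
      -- A proper nonempty closed E ⊂ C splits C into the closed parts E and C ─ E,
      -- and P passes to one of them.
      search {F} {C} (acc smaller) C⊆∁F neC clC pC
        with anySubset? (λ E → E ⊂? C ×-dec nonempty? E ×-dec closed? F E)
      ... | no ¬split = record
        { part⊆ = ⊆-refl ; nonempty = neC ; closed = clC ; satisfies = pC
        ; indecomposable = λ E E⊂C neE clE → ¬split (E , E⊂C , neE , clE) }
      ... | yes (E , E⊂C@(E⊆C , x , x∈C , x∉E) , neE@(e , e∈E) , clE) with P-split E⊆C pC
      ...   | inj₁ pE = widen E⊆C (search (smaller E⊂C) (⊆-trans E⊆C C⊆∁F) neE clE pE)
      ...   | inj₂ pC─E = widen (p─q⊆p C E)
        (search (smaller (p∩q≢∅⇒p─q⊂p C E (e , x∈p∩q⁺ (E⊆C e∈E , e∈E))))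
                (⊆-trans (p─q⊆p C E) C⊆∁F) (x , x∈p∧x∉q⇒x∈p─q x∈C x∉E)
                (closed-─ C⊆∁F clC clE) pC─E)

module _ (G : Graph n) (inX : Fin n → Bool) (bip : IsBipartition G inX) where
  open Graph G using (adj)

  X : Subset n
  X = tabulate inX

  opposite-sides : ∀ {u w} → Edge G u w → inX w ≡ not (inX u)
  opposite-sides {u} {w} e = ¬-not (bip u w e ∘ sym)

  different-sides : ∀ {u w} → inX u ≡ false → inX w ≡ true → u ≢ w
  different-sides u∈Y w∈X refl = contradiction (trans (sym u∈Y) w∈X) λ ()

  heavy-remove : ∀ {C v} → v ∈ C → Heavy X (inX v) C → Heavy X (not (inX v)) (C - v)
  heavy-remove {v = v} v∈C h with inX v in side
  ... | true  = heavy-remove-∈ X v∈C (x∈tabulate⁺ side) h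
  ... | false = heavy-remove-∉ X v∈C (λ v∈X → different-sides side (x∈tabulate⁻ v∈X) refl) h

  -- The state of the growing path: v is its current end and F the vertices before v.
  record Region (F C : Subset n) (v : Fin n) : Set where
    field
      start∈         : v ∈ C
      avoids         : C ⊆ ∁ F
      closed         : Closed G F C
      indecomposable : Indecomposable G F C
      heavy          : Heavy X (inX v) C

  record MaximalXPath (F C : Subset n) (v : Fin n) : Set where
    field
      rest      : List (Fin n)
      path      : IsPath G v rest
      within    : All (_∈ C) (v ∷ rest)
      ends-in-X : inX (terminus G v rest) ≡ true
      maximal   : ∀ w → Edge G (terminus G v rest) w → w ∈ F ⊎ w ∈ₗ v ∷ rest

  trivial-path : ∀ {F C v} → Region F C v → Empty (C - v) → MaximalXPath F C v
  trivial-path {F} {C} {v} R empty = record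
    { rest = [] ; path = [-] , [] ∷ [] ; within = start∈ ∷ []
    ; ends-in-X = start-in-X ; maximal = maximal }
    where
    open Region R
    start-in-X : inX v ≡ true
    start-in-X with inX v | heavy-remove start∈ heavy
    ... | true  | _      = refl
    ... | false | heavy′ = contradiction heavy′ (empty⇒¬heavy X empty)
    maximal : ∀ w → Edge G v w → w ∈ F ⊎ w ∈ₗ v ∷ []
    maximal w e with closed v w start∈ e
    ... | inj₂ w∈F = inj₁ w∈F
    ... | inj₁ w∈C with w ≟ v
    ...   | yes w≡v = inj₂ (here w≡v)
    ...   | no  w≢v = contradiction (w , x∈p∧x≢y⇒x∈p-y w∈C w≢v) empty

  extend : ∀ {F C D v x} → v ∈ C → D ⊆ C - v → Edge G v x →
           MaximalXPath (F ∪ ⁅ v ⁆) D x → MaximalXPath F C v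
  extend {F} {C} {D} {v} {x} v∈C D⊆C-v e P = record
    { rest      = x ∷ rest
    ; path      = e ∷ proj₁ path , All.map v≢ within ∷ proj₂ path
    ; within    = v∈C ∷ All.map (p─q⊆p C ⁅ v ⁆ ∘ D⊆C-v) within
    ; ends-in-X = ends-in-X
    ; maximal   = maximal′
    }
    where
    open MaximalXPath P
    v≢ : ∀ {u} → u ∈ D → v ≢ u
    v≢ u∈D v≡u = x∈p-y⇒x≢y (D⊆C-v u∈D) (sym v≡u)
    maximal′ : ∀ w → Edge G (terminus G x rest) w → w ∈ F ⊎ w ∈ₗ v ∷ x ∷ rest
    maximal′ w e′ with maximal w e′
    ... | inj₂ w∈path = inj₂ (there w∈path)
    ... | inj₁ w∈F∪v with x∈p∪q⁻ F ⁅ v ⁆ w∈F∪v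
    ...   | inj₁ w∈F = inj₁ w∈F
    ...   | inj₂ w∈v = inj₂ (here (x∈⁅y⁆⇒x≡y v w∈v))

  maximalXPath : ∀ {F C v} → Acc _⊂_ C → Region F C v → MaximalXPath F C v
  maximalXPath {F} {C} {v} (acc smaller) R with nonempty? (C - v)
  ... | no  empty = trivial-path R empty
  ... | yes ne    = descend
    (component G _ (heavy-split X _) (avoids-remove G avoids) ne
               (closed-remove G closed) (heavy-remove start∈ heavy))
    where
    open Region R
    descend : Component G (Heavy X (not (inX v))) (F ∪ ⁅ v ⁆) (C - v) → MaximalXPath F C v
    descend K =
      let x , x∈part , v–x = neighbour-in G indecomposable start∈ part⊆ nonempty part-closed
      in extend start∈ part⊆ v–x
           (maximalXPath (smaller (⊆-⊂-trans part⊆ (x∈p⇒p-x⊂p start∈))) record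
        { start∈         = x∈part
        ; avoids         = ⊆-trans part⊆ (avoids-remove G avoids)
        ; closed         = part-closed
        ; indecomposable = part-indecomposable
        ; heavy          = subst (λ b → Heavy X b part) (sym (opposite-sides v–x)) satisfies
        })
      where open Component K renaming (closed to part-closed; indecomposable to part-indecomposable)

  2∣S∣≤order : ∀ (S : Subset n) {v} rest → IsWalk G v rest → inX (terminus G v rest) ≡ true →
                 inX v ≡ false → (∀ {w} → w ∈ S → inX w ≡ false × w ∈ₗ v ∷ rest) →
                 2 * ∣ S ∣ ≤ order G v rest
  2∣S∣<order : ∀ (S : Subset n) {v} rest → IsWalk G v rest → inX (terminus G v rest) ≡ true →
                 inX v ≡ true → (∀ {w} → w ∈ S → inX w ≡ false × w ∈ₗ v ∷ rest) →
                 2 * ∣ S ∣ < order G v rest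

  2∣S∣≤order S []       _          t∈X v∈Y _     = contradiction refl (different-sides v∈Y t∈X)
  2∣S∣≤order S {v} (y ∷ ys) (e ∷ walk) t∈X v∈Y cover = begin
    2 * ∣ S ∣          ≤⟨ *-monoʳ-≤ 2 (∣p∣≤1+∣p-x∣ S v) ⟩
    2 * suc ∣ S - v ∣  ≡⟨ *-suc 2 ∣ S - v ∣ ⟩
    2 + 2 * ∣ S - v ∣  ≤⟨ s≤s (2∣S∣<order (S - v) ys walk t∈X y∈X cover′) ⟩
    order G v (y ∷ ys) ∎
    where
    open ≤-Reasoning
    y∈X : inX y ≡ true
    y∈X = trans (opposite-sides e) (cong not v∈Y)
    cover′ : ∀ {w} → w ∈ S - v → inX w ≡ false × w ∈ₗ y ∷ ys
    cover′ w∈S-v with cover (p─q⊆p S ⁅ v ⁆ w∈S-v)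
    ... | w∈Y , w∈path = w∈Y , ∈ₗ-tail w∈path (x∈p-y⇒x≢y w∈S-v)

  2∣S∣<order S []       _          _   v∈X cover =
    subst (λ k → 2 * k < 1) (sym (Empty⇒∣p∣≡0 S-empty)) (s≤s z≤n)
    where
    S-empty : Empty S
    S-empty (w , w∈S) with cover w∈S
    ... | w∈Y , here w≡v = different-sides w∈Y v∈X w≡v
  2∣S∣<order S (y ∷ ys) (e ∷ walk) t∈X v∈X cover =
    s≤s (2∣S∣≤order S ys walk t∈X (trans (opposite-sides e) (cong not v∈X)) cover′)
    where
    cover′ : ∀ {w} → w ∈ S → inX w ≡ false × w ∈ₗ y ∷ ys
    cover′ w∈S with cover w∈S
    ... | w∈Y , w∈path = w∈Y , ∈ₗ-tail w∈path (λ w≡v → different-sides w∈Y v∈X w≡v)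

  neighbourhood-covered : ∀ {v rest} → IsMaximalPath G v rest → inX (terminus G v rest) ≡ true →
    ∀ {w} → w ∈ tabulate (adj (terminus G v rest)) → inX w ≡ false × w ∈ₗ v ∷ rest
  neighbourhood-covered (_ , maximal) t∈X w∈N =
    trans (opposite-sides (x∈tabulate⁻ w∈N)) (cong not t∈X) , maximal _ (x∈tabulate⁻ w∈N)

  2*degree≤order : ∀ {v rest} → IsMaximalPath G v rest → inX (terminus G v rest) ≡ true → inX v ≡ false →
                   2 * degree G (terminus G v rest) ≤ order G v rest
  2*degree≤order {v} {rest} M@((walk , _) , _) t∈X v∈Y =
    subst (λ k → 2 * k ≤ order G v rest) (sym (countV≡∣tabulate∣ G _))
      (2∣S∣≤order _ rest walk t∈X v∈Y (neighbourhood-covered M t∈X))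

  2*degree<order : ∀ {v rest} → IsMaximalPath G v rest → inX (terminus G v rest) ≡ true → inX v ≡ true →
                   2 * degree G (terminus G v rest) < order G v rest
  2*degree<order {v} {rest} M@((walk , _) , _) t∈X v∈X =
    subst (λ k → 2 * k < order G v rest) (sym (countV≡∣tabulate∣ G _))
      (2∣S∣<order _ rest walk t∈X v∈X (neighbourhood-covered M t∈X))

  ∣⊤∩X∣≡countV : ∣ ⊤ ∩ X ∣ ≡ countV G inX
  ∣⊤∩X∣≡countV = trans (cong ∣_∣ (∩-identityˡ X)) (sym (countV≡∣tabulate∣ G inX))

  ∣⊤∩∁X∣≡countV : ∣ ⊤ ∩ ∁ X ∣ ≡ countV G (λ v → not (inX v))
  ∣⊤∩∁X∣≡countV = trans (cong ∣_∣ (trans (∩-identityˡ (∁ X)) (sym (tabulate-∘ not inX))))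
                        (sym (countV≡∣tabulate∣ G _))

  ⊤-heavy-false : countV G (λ v → not (inX v)) ≤ countV G inX → Heavy X false ⊤
  ⊤-heavy-false = subst₂ _≤_ (sym ∣⊤∩∁X∣≡countV) (sym ∣⊤∩X∣≡countV)

  ⊤-heavy-true : countV G (λ v → not (inX v)) < countV G inX → Heavy X true ⊤
  ⊤-heavy-true = subst₂ _<_ (sym ∣⊤∩∁X∣≡countV) (sym ∣⊤∩X∣≡countV)

  whole-region : Connected G → ∀ {v b} → inX v ≡ b → Heavy X b ⊤ → Region ⊥ ⊤ v
  whole-region conn refl heavy = record
    { start∈ = ∈⊤ ; avoids = λ _ → x∉p⇒x∈∁p ∉⊥ ; closed = λ _ _ _ _ → inj₁ ∈⊤
    ; indecomposable = connected⇒indecomposable G conn ; heavy = heavy }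

  maximal-path : Connected G → ∀ {v b} → inX v ≡ b → Heavy X b ⊤ →
                 ∃ λ rest → IsMaximalPath G v rest × inX (terminus G v rest) ≡ true
  maximal-path conn {v} side heavy = rest , (path , maximal-in-G) , ends-in-X
    where
    open MaximalXPath (maximalXPath (⊂-wellFounded ⊤) (whole-region conn side heavy))
    maximal-in-G : ∀ w → Edge G (terminus G v rest) w → w ∈ₗ v ∷ rest
    maximal-in-G w e = [ (λ w∈⊥ → contradiction w∈⊥ ∉⊥) , (λ w∈path → w∈path) ]′ (maximal w e)

lemma2p1 : {n : ℕ} (G : Graph n) (inX : Fin n → Bool) (d : ℕ) →
    Connected G → IsBipartition G inX →
    (∀ x → inX x ≡ true → d ≤ degree G x) →
    (countV G (λ v → not (inX v)) ≤ countV G inX →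
      ∀ y₀ → inX y₀ ≡ false →
      Σ (List (Fin n)) λ rest →
        IsMaximalPath G y₀ rest × inX (terminus G y₀ rest) ≡ true × 2 * d ≤ order G y₀ rest)
    ×
    (countV G (λ v → not (inX v)) < countV G inX →
      ∀ x₀ → inX x₀ ≡ true →
      Σ (List (Fin n)) λ rest →
        IsMaximalPath G x₀ rest × inX (terminus G x₀ rest) ≡ true × 2 * d < order G x₀ rest)
lemma2p1 G inX d conn bip d≤degree =
  (λ ∣Y∣≤∣X∣ y₀ y₀∈Y →
    let rest , M , t∈X = maximal-path G inX bip conn y₀∈Y (⊤-heavy-false G inX bip ∣Y∣≤∣X∣)
    in rest , M , t∈X ,
       ≤-trans (*-monoʳ-≤ 2 (d≤degree _ t∈X)) (2*degree≤order G inX bip M t∈X y₀∈Y)) ,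
  (λ ∣Y∣<∣X∣ x₀ x₀∈X →
    let rest , M , t∈X = maximal-path G inX bip conn x₀∈X (⊤-heavy-true G inX bip ∣Y∣<∣X∣)
    in rest , M , t∈X ,
       ≤-<-trans (*-monoʳ-≤ 2 (d≤degree _ t∈X)) (2*degree<order G inX bip M t∈X x₀∈X))
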